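{- Let $A=(Ctrl,Sto,\mathit{init},\mathit{fin},\to)$ and $A'=(Ctrl',Sto',\mathit{init}',\mathit{fin}',\to')$ be automata, $L,R,J$ live alignment conditions for $A,A'$, and $\mathcal{Q},\mathcal{S}\subseteq Sto\times Sto'$. Suppose $\prod(A,A',L,R,J)$ is $\mathcal{Q}$-adequate. Then $\prod(A,A',L,R,J)\models\{\mathcal{Q}\}\{\mathcal{S}\}$ if and only if $A,A'\models\langle\mathcal{Q}\Rightarrow\mathcal{S}\rangle$.
   Context: An automaton is a tuple $(Ctrl,Sto,\mathit{init},\mathit{fin},\to)$ where $Sto$ is a set, $Ctrl$ a finite set containing distinct $\mathit{init},\mathit{fin}$, and $\to\ \subseteq(Ctrl\times Sto)\times(Ctrl\times Sto)$ with $(n,s)\to(m,t)$ implying $n\neq\mathit{fin}$ and $n\neq m$. For an automaton $B$ with stores $Sto_B$ and $P,Q\subseteq Sto_B$, $B\models\{P\}\{Q\}$ means: for all $s,t$ with $(\mathit{init},s)\to^*(\mathit{fin},t)$, if $s\in P$ then $t\in Q$. For automata $A,A'$ and relations $\mathcal{R},\mathcal{S}\subseteq Sto\times Sto'$, $A,A'\models\langle\mathcal{R}\Rightarrow\mathcal{S}\rangle$ means: for all $s,s',t,t'$ with $(\mathit{init},s)\to^*(\mathit{fin},t)$ and $(\mathit{init}',s')\to'^*(\mathit{fin}',t')$, if $(s,s')\in\mathcal{R}$ then $(t,t')\in\mathcal{S}$. Sets $L,R,J\subseteq(Ctrl\times Ctrl')\times(Sto\times Sto')$ are live if states in $L$ have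 a $\to$-successor on the left, states in $R$ have a $\to'$-successor on the right, and states in $J$ have both. The alignment automaton $\prod(A,A',L,R,J)$ is $(Ctrl\times Ctrl',Sto\times Sto',(\mathit{init},\mathit{init}'),(\mathit{fin},\mathit{fin}'),\Rightarrow)$ where $((n,n'),(s,s'))\Rightarrow((m,m'),(t,t'))$ iff (LO) the source is in $L$, $(n,s)\to(m,t)$, $(n',s')=(m',t')$; or (RO) the source is in $R$, $(n,s)=(m,t)$, $(n',s')\to'(m',t')$; or (JO) the source is in $J$, $(n,s)\to(m,t)$, $(n',s')\to'(m',t')$. Its stores are pairs, so a store relation is a store predicate of the product. The product is $\mathcal{Q}$-adequate if for all $(s,s')\in\mathcal{Q}$ and $t,t'$ with $(\mathit{init},s)\to^*(\mathit{fin},t)$ and $(\mathit{init}',s')\to'^*(\mathit{fin}',t')$ we have $((\mathit{init},\mathit{init}'),(s,s'))\Rightarrow^*((\mathit{fin},\mathit{fin}'),(t,t'))$. -}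

module Defs where

open import Level using (Level; 0ℓ)
open import Data.Nat using (ℕ) renaming (_*_ to _ℕ*_)
open import Data.Fin using (Fin; combine; remQuot)
open import Data.Fin.Properties using (remQuot-combine)
open import Data.Product using (Σ; ∃; _×_; _,_; proj₁; proj₂)
open import Relation.Nullary using (¬_)
open import Relation.Binary.PropositionalEquality using (_≡_; _≢_; refl; cong)
open import Relation.Binary.Construct.Closure.ReflexiveTransitive using (Star)

IsFinite : Set → Set
IsFinite C = Σ ℕ λ n → Σ (Fin n → C) λ f → ∀ c → ∃ λ i → f i ≡ c

record Automaton : Set₁ where
  field
    Ctrl     : Set
    ctrlFin  : IsFinite Ctrl
    Sto      : Set
    init     : Ctrl
    fin      : Ctrl
    init≢fin : init ≢ fin
    _↦_      : Ctrl × Sto → Ctrl × Sto → Set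
    noFromFin : ∀ {n s m t} → (n , s) ↦ (m , t) → n ≢ fin
    noSelf    : ∀ {n s m t} → (n , s) ↦ (m , t) → n ≢ m

  _↦*_ : Ctrl × Sto → Ctrl × Sto → Set
  _↦*_ = Star _↦_

open Automaton public

StoPred : Automaton → Set₁
StoPred B = Sto B → Set

_⊨⟦_⟧⟦_⟧ : (B : Automaton) → StoPred B → StoPred B → Set
B ⊨⟦ P ⟧⟦ Q ⟧ = ∀ s t → _↦*_ B (init B , s) (fin B , t) → P s → Q t

StoRel : Automaton → Automaton → Set₁
StoRel A A' = Sto A → Sto A' → Set

RelHoare : (A A' : Automaton) → StoRel A A' → StoRel A A' → Set
RelHoare A A' R S = ∀ s s' t t' →
  _↦*_ A (init A , s) (fin A , t) →
  _↦*_ A' (init A' , s') (fin A' , t') →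
  R s s' → S t t'

AlignSet : Automaton → Automaton → Set₁
AlignSet A A' = (Ctrl A × Ctrl A') × (Sto A × Sto A') → Set

Live : (A A' : Automaton) → AlignSet A A' → AlignSet A A' → AlignSet A A' → Set
Live A A' L R J =
  (∀ n n' s s' → L ((n , n') , (s , s')) → ∃ λ mt → _↦_ A (n , s) mt)
  × (∀ n n' s s' → R ((n , n') , (s , s')) → ∃ λ mt' → _↦_ A' (n' , s') mt')
  × (∀ n n' s s' → J ((n , n') , (s , s')) →
       (∃ λ mt → _↦_ A (n , s) mt) × (∃ λ mt' → _↦_ A' (n' , s') mt'))

data ProdStep (A A' : Automaton) (L R J : AlignSet A A') :
  (Ctrl A × Ctrl A') × (Sto A × Sto A') → (Ctrl A × Ctrl A') × (Sto A × Sto A') → Set where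
  LO : ∀ {n n' s s' m t} → L ((n , n') , (s , s')) → _↦_ A (n , s) (m , t) →
       ProdStep A A' L R J ((n , n') , (s , s')) ((m , n') , (t , s'))
  RO : ∀ {n n' s s' m' t'} → R ((n , n') , (s , s')) → _↦_ A' (n' , s') (m' , t') →
       ProdStep A A' L R J ((n , n') , (s , s')) ((n , m') , (s , t'))
  JO : ∀ {n n' s s' m m' t t'} → J ((n , n') , (s , s')) →
       _↦_ A (n , s) (m , t) → _↦_ A' (n' , s') (m' , t') →
       ProdStep A A' L R J ((n , n') , (s , s')) ((m , m') , (t , t'))

pairFinite : ∀ {C D : Set} → IsFinite C → IsFinite D → IsFinite (C × D)
pairFinite {C} {D} (n , f , fs) (k , g , gs) = (n ℕ* k) , h , hs
  where
    h : Fin (n ℕ* k) → C × D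
    h i = f (proj₁ (remQuot {n} k i)) , g (proj₂ (remQuot {n} k i))
    hs : ∀ cd → ∃ λ i → h i ≡ cd
    hs (c , d) with fs c | gs d
    ... | (a , refl) | (b , refl) = combine a b ,
          cong (λ p → f (proj₁ p) , g (proj₂ p)) (remQuot-combine {n} {k} a b)

Prod : (A A' : Automaton) → AlignSet A A' → AlignSet A A' → AlignSet A A' → Automaton
Prod A A' L R J = record
  { Ctrl = Ctrl A × Ctrl A'
  ; ctrlFin = pairFinite (ctrlFin A) (ctrlFin A')
  ; Sto = Sto A × Sto A'
  ; init = init A , init A'
  ; fin = fin A , fin A'
  ; init≢fin = λ eq → init≢fin A (cong proj₁ eq)
  ; _↦_ = ProdStep A A' L R J
  ; noFromFin = nf
  ; noSelf = ns
  }
  where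
    nf : ∀ {n s m t} → ProdStep A A' L R J (n , s) (m , t) → n ≢ (fin A , fin A')
    nf (LO _ st) eq = noFromFin A st (cong proj₁ eq)
    nf (RO _ st) eq = noFromFin A' st (cong proj₂ eq)
    nf (JO _ st _) eq = noFromFin A st (cong proj₁ eq)
    ns : ∀ {n s m t} → ProdStep A A' L R J (n , s) (m , t) → n ≢ m
    ns (LO _ st) eq = noSelf A st (cong proj₁ eq)
    ns (RO _ st) eq = noSelf A' st (cong proj₂ eq)
    ns (JO _ st _) eq = noSelf A st (cong proj₁ eq)

Adequate : (A A' : Automaton) (L R J : AlignSet A A') → StoRel A A' → Set
Adequate A A' L R J Q = ∀ s s' t t' → Q s s' →
  _↦*_ A (init A , s) (fin A , t) →
  _↦*_ A' (init A' , s') (fin A' , t') →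
  _↦*_ (Prod A A' L R J) ((init A , init A') , (s , s')) ((fin A , fin A') , (t , t'))

relPred : (A A' : Automaton) → StoRel A A' → (Sto A × Sto A' → Set)
relPred A A' Q (s , s') = Q s s'

{-# OPTIONS --safe #-}
module Submission where

-- A run of the product interleaves steps of A and A', so it projects to a run of each
-- component; this makes every product triple sound for the relational judgement.
-- Conversely, adequacy lifts every pair of component runs from a Q-related pair of
-- stores to a single product run, so a relational judgement yields the product triple.

open import Defs
open import Data.Product using (_×_; _,_)
open import Relation.Binary.Construct.Closure.ReflexiveTransitive using (ε; _◅_)

module _ (A A' : Automaton) (L R J : AlignSet A A') where

  private
    Π = Prod A A' L R J

  ⇒*-projectˡ : ∀ {n n' s s' m m' t t'} →
    _↦*_ Π ((n , n') , (s , s')) ((m , m') , (t , t')) → _↦*_ A (n , s) (m , t)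
  ⇒*-projectˡ ε                 = ε
  ⇒*-projectˡ (LO _ st   ◅ run) = st ◅ ⇒*-projectˡ run
  ⇒*-projectˡ (RO _ _    ◅ run) = ⇒*-projectˡ run
  ⇒*-projectˡ (JO _ st _ ◅ run) = st ◅ ⇒*-projectˡ run

  ⇒*-projectʳ : ∀ {n n' s s' m m' t t'} →
    _↦*_ Π ((n , n') , (s , s')) ((m , m') , (t , t')) → _↦*_ A' (n' , s') (m' , t')
  ⇒*-projectʳ ε                  = ε
  ⇒*-projectʳ (LO _ _     ◅ run) = ⇒*-projectʳ run
  ⇒*-projectʳ (RO _ st'   ◅ run) = st' ◅ ⇒*-projectʳ run
  ⇒*-projectʳ (JO _ _ st' ◅ run) = st' ◅ ⇒*-projectʳ run

  prod-hoare⇒rel-hoare : (Q S : StoRel A A') → Adequate A A' L R J Q →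
    Π ⊨⟦ relPred A A' Q ⟧⟦ relPred A A' S ⟧ → RelHoare A A' Q S
  prod-hoare⇒rel-hoare Q S adequate triple s s' t t' run run' q =
    triple (s , s') (t , t') (adequate s s' t t' q run run') q

  rel-hoare⇒prod-hoare : (Q S : StoRel A A') →
    RelHoare A A' Q S → Π ⊨⟦ relPred A A' Q ⟧⟦ relPred A A' S ⟧
  rel-hoare⇒prod-hoare Q S judgement (s , s') (t , t') run q =
    judgement s s' t t' (⇒*-projectˡ run) (⇒*-projectʳ run) q

-- Liveness is unused: adequacy already supplies the product runs it would guarantee.
lemma4p6 : (A A' : Automaton) (L R J : AlignSet A A') → Live A A' L R J →
    (Q S : StoRel A A') → Adequate A A' L R J Q →
    ((Prod A A' L R J ⊨⟦ relPred A A' Q ⟧⟦ relPred A A' S ⟧) → RelHoare A A' Q S)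
    × (RelHoare A A' Q S → (Prod A A' L R J ⊨⟦ relPred A A' Q ⟧⟦ relPred A A' S ⟧))
lemma4p6 A A' L R J _ Q S adequate =
  prod-hoare⇒rel-hoare A A' L R J Q S adequate , rel-hoare⇒prod-hoare A A' L R J Q S
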